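{- Let $q$ be a prime power and $n \ge 3$ an integer. Then $\mathcal{A}_q(n,n-1,n-2;q) = q^{n-1}$.
   Context: A $t$-$(n,k,\lambda)_q$ subspace packing is a collection of $k$-dimensional subspaces (blocks) of $\mathbb{F}_q^n$ such that every $t$-dimensional subspace of $\mathbb{F}_q^n$ is contained in at most $\lambda$ blocks. $\mathcal{A}_q(n,k,t;\lambda)$ denotes the maximum number of blocks of such a packing without repeated blocks (i.e., the blocks form a set). -}

module Defs where

open import Data.Nat using (ℕ; zero; suc; _≤_)
open import Data.Fin using (Fin; zero; suc)
open import Data.Vec using (Vec; replicate; zipWith; map)
open import Data.Product using (Σ; ∃; _×_; _,_)
open import Relation.Nullary using (¬_)
open import Relation.Binary.PropositionalEquality using (_≡_; _≢_)
open import Function.Bundles using (_↔_)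
open import Function.Definitions using (Injective)
open import Algebra.Structures using (IsCommutativeRing)

record FiniteField (q : ℕ) : Set₁ where
  field
    Carrier : Set
    _+_ _*_ : Carrier → Carrier → Carrier
    -_ : Carrier → Carrier
    0# 1# : Carrier
    isCommutativeRing : IsCommutativeRing _≡_ _+_ _*_ -_ 0# 1#
    0≢1 : 0# ≢ 1#
    inverse : ∀ x → x ≢ 0# → ∃ λ y → x * y ≡ 1#
    enumeration : Fin q ↔ Carrier

module _ {q : ℕ} (F : FiniteField q) where
  open FiniteField F

  Vecₙ : ℕ → Set
  Vecₙ n = Vec Carrier n

  lincomb : ∀ {n k} → (Fin k → Carrier) → (Fin k → Vecₙ n) → Vecₙ n
  lincomb {n} {zero} c b = replicate n 0#
  lincomb {n} {suc k} c b =
    zipWith _+_ (map (c zero *_) (b zero)) (lincomb (λ i → c (suc i)) (λ i → b (suc i)))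

  _∈span_ : ∀ {n k} → Vecₙ n → (Fin k → Vecₙ n) → Set
  v ∈span b = ∃ λ c → v ≡ lincomb c b

  LinIndep : ∀ {n k} → (Fin k → Vecₙ n) → Set
  LinIndep {n} b = ∀ c → lincomb c b ≡ replicate n 0# → ∀ i → c i ≡ 0#

  _⊆span_ : ∀ {n k l} → (Fin k → Vecₙ n) → (Fin l → Vecₙ n) → Set
  a ⊆span b = ∀ i → a i ∈span b

  SameSpan : ∀ {n k l} → (Fin k → Vecₙ n) → (Fin l → Vecₙ n) → Set
  SameSpan a b = (a ⊆span b) × (b ⊆span a)

  -- A k-dimensional subspace of F_q^n is represented by a basis (k linearly
  -- independent vectors); two bases represent the same subspace iff SameSpan.
  -- A t-(n,k,λ)_q subspace packing without repeated blocks with N blocks: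
  -- blocks B 0, ..., B (N-1), pairwise distinct subspaces, and every
  -- t-dimensional subspace T lies in at most λ blocks.
  record IsPacking (n k t λ' N : ℕ) (B : Fin N → Fin k → Vecₙ n) : Set where
    field
      blocks-indep : ∀ i → LinIndep (B i)
      blocks-distinct : ∀ i j → i ≢ j → ¬ SameSpan (B i) (B j)
      at-most-λ : (T : Fin t → Vecₙ n) → LinIndep T →
                  ∀ m (f : Fin m → Fin N) → Injective _≡_ _≡_ f →
                  (∀ j → T ⊆span B (f j)) → m ≤ λ'

  Aq≡ : (n k t λ' M : ℕ) → Set
  Aq≡ n k t λ' M =
    (Σ (Fin M → Fin k → Vecₙ n) λ B → IsPacking n k t λ' M B) ×
    (∀ N (B : Fin N → Fin k → Vecₙ n) → IsPacking n k t λ' N B → N ≤ M)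

module Submission where

-- For n ≥ 3, 𝒜_q(n, n-1, n-2; q) = q^(n-1): the blocks are hyperplanes of F^n, each the
-- orthogonal complement a⊥ of a normal vector a, and we write n = m + 2.
--
-- Lower bound: the q^(m+1) affine hyperplanes { v | v₀ = c · (v₁, …, v_(m+1)) } form a packing,
-- because the points c of the affine hyperplanes through m independent vectors are determined
-- by a single coordinate, so there are at most q of them (affine-pencil-≤q).
--
-- Upper bound: fix a coordinate j₀ at which the normal of block 0 is nonzero, and label every
-- block by a hyperplane whose normal has j₀-coordinate 1: an affine block by itself, any other
-- block by a member of its pencil with block 0 that is not a block. Such a member exists, or
-- the q + 1 hyperplanes of that pencil would all be blocks through a common m-dimensional
-- subspace. Labels are distinct, and there are q^(m+1) possible labels.

open import Defs
open import Data.Nat using (ℕ; zero; suc; _≤_; _∸_; _^_; z≤n; s≤s)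
import Data.Nat.Properties as ℕ
open import Data.Fin using (Fin; zero; suc; punchIn; punchOut; combine; funToFin; finToFun)
import Data.Fin.Properties as Fin
open import Data.Vec as Vec using (Vec; lookup)
import Data.Vec.Properties as Vecₚ
open import Data.Vec.Functional using (_∷_; insertAt; removeAt)
open import Data.Vec.Functional.Properties using (insertAt-lookup; insertAt-punchIn)
open import Data.Product using (Σ; ∃; _×_; _,_; proj₁; proj₂)
open import Data.Empty using (⊥-elim)
open import Relation.Nullary using (¬_; Dec; yes; no)
import Relation.Nullary.Decidable as Dec
open import Relation.Binary.PropositionalEquality
open import Function.Bundles using (Inverse)
open import Function.Definitions using (Injective)
open import Algebra.Bundles using (CommutativeRing)

module _ {q : ℕ} (F : FiniteField q) where
  open FiniteField F using (Carrier; 0≢1; inverse; enumeration)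

  𝔽 : CommutativeRing _ _
  𝔽 = record { isCommutativeRing = FiniteField.isCommutativeRing F }

  open CommutativeRing 𝔽
    using (_+_; _*_; -_; 0#; 1#; +-comm; +-identityˡ; +-identityʳ; -‿inverseʳ;
           *-assoc; *-comm; *-identityˡ; *-identityʳ; distribˡ; distribʳ; zeroˡ; zeroʳ;
           +-group; ring; semiring)
  open import Algebra.Properties.Group +-group
    using (∙-cancelˡ; inverseˡ-unique; x∙y⁻¹≈ε⇒x≈y; ⁻¹-injective)
  open import Algebra.Properties.Ring ring using (-‿distribˡ-*; -‿distribʳ-*; -1*x≈-x)
  open import Algebra.Properties.Semiring.Sum semiring
    using (sum; sum-cong-≗; sum-replicate-zero; sum-remove; ∑-distrib-+; ∑-comm;
           *-distribˡ-sum; *-distribʳ-sum)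
  module E = Inverse enumeration
  open ≡-Reasoning

  -- Field arithmetic.

  -- Equality of field elements is decidable: compare their indices in the enumeration.
  from-injective : ∀ {x y} → E.from x ≡ E.from y → x ≡ y
  from-injective {x} {y} e = trans (sym (E.strictlyInverseˡ x)) (trans (cong E.to e) (E.strictlyInverseˡ y))

  infix 4 _≟_
  _≟_ : (x y : Carrier) → Dec (x ≡ y)
  x ≟ y = Dec.map′ from-injective (cong E.from) (E.from x Fin.≟ E.from y)

  1≢0 : 1# ≢ 0#
  1≢0 e = 0≢1 (sym e)

  -- The inverse, extended to a total operation by 0⁻¹ = 0.
  _⁻¹ : Carrier → Carrier
  x ⁻¹ with x ≟ 0#
  ... | yes _   = 0#
  ... | no x≢0  = proj₁ (inverse x x≢0)

  ⁻¹-inverse : ∀ {x} → x ≢ 0# → x ⁻¹ * x ≡ 1#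
  ⁻¹-inverse {x} x≢0 with x ≟ 0#
  ... | yes x≡0 = ⊥-elim (x≢0 x≡0)
  ... | no x≢0  = trans (*-comm _ x) (proj₂ (inverse x x≢0))

  ⁻¹-cancelˡ : ∀ {x} → x ≢ 0# → ∀ y → x ⁻¹ * (x * y) ≡ y
  ⁻¹-cancelˡ {x} x≢0 y = begin
    x ⁻¹ * (x * y) ≡⟨ sym (*-assoc _ x y) ⟩
    (x ⁻¹ * x) * y ≡⟨ cong (_* y) (⁻¹-inverse x≢0) ⟩
    1# * y         ≡⟨ *-identityˡ y ⟩
    y              ∎

  ⁻¹-cancelˡ′ : ∀ {x} → x ≢ 0# → ∀ y → x * (x ⁻¹ * y) ≡ y
  ⁻¹-cancelˡ′ {x} x≢0 y = begin
    x * (x ⁻¹ * y) ≡⟨ sym (*-assoc x _ y) ⟩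
    (x * x ⁻¹) * y ≡⟨ cong (_* y) (trans (*-comm x _) (⁻¹-inverse x≢0)) ⟩
    1# * y         ≡⟨ *-identityˡ y ⟩
    y              ∎

  ⁻¹-cancelʳ : ∀ {x} → x ≢ 0# → ∀ y → (y * x ⁻¹) * x ≡ y
  ⁻¹-cancelʳ {x} x≢0 y = begin
    (y * x ⁻¹) * x ≡⟨ *-assoc y _ x ⟩
    y * (x ⁻¹ * x) ≡⟨ cong (y *_) (⁻¹-inverse x≢0) ⟩
    y * 1#         ≡⟨ *-identityʳ y ⟩
    y              ∎

  *-cancel-nonzero : ∀ x y → x ≢ 0# → x * y ≡ 0# → y ≡ 0#
  *-cancel-nonzero x y x≢0 xy≡0 = begin
    y              ≡⟨ sym (⁻¹-cancelˡ x≢0 y) ⟩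
    x ⁻¹ * (x * y) ≡⟨ cong (x ⁻¹ *_) xy≡0 ⟩
    x ⁻¹ * 0#      ≡⟨ zeroʳ _ ⟩
    0#             ∎

  *-nonzero : ∀ x y → x ≢ 0# → y ≢ 0# → x * y ≢ 0#
  *-nonzero x y x≢0 y≢0 xy≡0 = y≢0 (*-cancel-nonzero x y x≢0 xy≡0)

  *-cancelʳ-nonzero : ∀ {z} x y → z ≢ 0# → x * z ≡ y * z → x ≡ y
  *-cancelʳ-nonzero {z} x y z≢0 xz≡yz = begin
    x              ≡⟨ sym (⁻¹-cancelˡ z≢0 x) ⟩
    z ⁻¹ * (z * x) ≡⟨ cong (λ w → z ⁻¹ * w) (trans (*-comm z x) (trans xz≡yz (*-comm y z))) ⟩
    z ⁻¹ * (z * y) ≡⟨ ⁻¹-cancelˡ z≢0 y ⟩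
    y              ∎

  ⁻¹-nonzero : ∀ {x} → x ≢ 0# → x ⁻¹ ≢ 0#
  ⁻¹-nonzero {x} x≢0 e = 1≢0 (trans (sym (⁻¹-inverse x≢0)) (trans (cong (_* x) e) (zeroˡ x)))

  pivot-elimination : ∀ x {y} → y ≢ 0# → x + (- (x * y ⁻¹)) * y ≡ 0#
  pivot-elimination x {y} y≢0 = begin
    x + (- (x * y ⁻¹)) * y ≡⟨ cong (x +_) (sym (-‿distribˡ-* _ y)) ⟩
    x + - ((x * y ⁻¹) * y) ≡⟨ cong (λ z → x + - z) (⁻¹-cancelʳ y≢0 x) ⟩
    x + - x                ≡⟨ -‿inverseʳ x ⟩
    0#                     ∎

  -- Vectors of F^n as functions on coordinates, linear combinations and the standard
  -- bilinear form; a nonzero a is the normal vector of the hyperplane a⊥ = { v | a · v = 0 }.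

  V : ℕ → Set
  V n = Fin n → Carrier

  comb : ∀ {n k} → V k → (Fin k → V n) → V n
  comb c b j = sum (λ i → c i * b i j)

  infix 7 _·_
  _·_ : ∀ {n} → V n → V n → Carrier
  a · v = sum (λ j → a j * v j)

  ·-congʳ : ∀ {n} (a : V n) {v w : V n} → (∀ j → v j ≡ w j) → a · v ≡ a · w
  ·-congʳ a v≡w = sum-cong-≗ (λ j → cong (a j *_) (v≡w j))

  ·-congˡ : ∀ {n} {a b : V n} (v : V n) → (∀ j → a j ≡ b j) → a · v ≡ b · v
  ·-congˡ v a≡b = sum-cong-≗ (λ j → cong (_* v j) (a≡b j))

  ·-comm : ∀ {n} (a v : V n) → a · v ≡ v · a
  ·-comm a v = sum-cong-≗ (λ j → *-comm (a j) (v j))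

  Independent : ∀ {n k} → (Fin k → V n) → Set
  Independent b = ∀ c → (∀ j → comb c b j ≡ 0#) → ∀ i → c i ≡ 0#

  infix 4 _∈⟨_⟩
  _∈⟨_⟩ : ∀ {n k} → V n → (Fin k → V n) → Set
  v ∈⟨ b ⟩ = ∃ λ c → ∀ j → v j ≡ comb c b j

  Dependent : ∀ {n k} → (Fin k → V n) → Set
  Dependent {k = k} b = Σ (V k) λ c → (∃ λ i → c i ≢ 0#) × (∀ j → comb c b j ≡ 0#)

  ∈⟨⟩-resp : ∀ {n k} {v w : V n} {b : Fin k → V n} → (∀ j → v j ≡ w j) → v ∈⟨ b ⟩ → w ∈⟨ b ⟩
  ∈⟨⟩-resp v≗w (c , v≡cb) = c , λ j → trans (sym (v≗w j)) (v≡cb j)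

  sum-zero : ∀ {k} (f : V k) → (∀ i → f i ≡ 0#) → sum f ≡ 0#
  sum-zero {k} f f≡0 = trans (sum-cong-≗ f≡0) (sum-replicate-zero k)

  comb-cong : ∀ {n k} (c : V k) {b b' : Fin k → V n} → (∀ i j → b i j ≡ b' i j) →
              ∀ j → comb c b j ≡ comb c b' j
  comb-cong c b≡b' j = sum-cong-≗ (λ i → cong (c i *_) (b≡b' i j))

  ·-comb : ∀ {n k} (a : V n) (c : V k) (b : Fin k → V n) →
           a · comb c b ≡ sum (λ i → c i * (a · b i))
  ·-comb {n} {k} a c b = begin
    sum (λ j → a j * sum (λ i → c i * b i j))   ≡⟨ sum-cong-≗ (λ j → *-distribˡ-sum {k} (a j) _) ⟩
    sum (λ j → sum (λ i → a j * (c i * b i j))) ≡⟨ ∑-comm (λ j i → a j * (c i * b i j)) ⟩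
    sum (λ i → sum (λ j → a j * (c i * b i j))) ≡⟨ sum-cong-≗ (λ i → sum-cong-≗ (λ j → swap-left (a j) (c i) _)) ⟩
    sum (λ i → sum (λ j → c i * (a j * b i j))) ≡⟨ sum-cong-≗ (λ i → sym (*-distribˡ-sum {n} (c i) _)) ⟩
    sum (λ i → c i * (a · b i))                 ∎
    where
      swap-left : ∀ x y z → x * (y * z) ≡ y * (x * z)
      swap-left x y z = trans (sym (*-assoc x y z)) (trans (cong (_* z) (*-comm x y)) (*-assoc y x z))

  span⊆⊥ : ∀ {n k} (a : V n) (b : Fin k → V n) → (∀ i → a · b i ≡ 0#) → ∀ v → v ∈⟨ b ⟩ → a · v ≡ 0#
  span⊆⊥ a b b⊥a v (c , v≡cb) = begin
    a · v                       ≡⟨ ·-congʳ a v≡cb ⟩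
    a · comb c b                ≡⟨ ·-comb a c b ⟩
    sum (λ i → c i * (a · b i)) ≡⟨ sum-zero _ (λ i → trans (cong (c i *_) (b⊥a i)) (zeroʳ (c i))) ⟩
    0#                          ∎

  agree-on-span : ∀ {n k} (g h : V n) (b : Fin k → V n) → (∀ i → g · b i ≡ h · b i) →
                  ∀ v → v ∈⟨ b ⟩ → g · v ≡ h · v
  agree-on-span g h b agree v (c , v≡cb) = begin
    g · v                       ≡⟨ ·-congʳ g v≡cb ⟩
    g · comb c b                ≡⟨ ·-comb g c b ⟩
    sum (λ i → c i * (g · b i)) ≡⟨ sum-cong-≗ (λ i → cong (c i *_) (agree i)) ⟩
    sum (λ i → c i * (h · b i)) ≡⟨ sym (·-comb h c b) ⟩
    h · comb c b                ≡⟨ ·-congʳ h (λ j → sym (v≡cb j)) ⟩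
    h · v                       ∎

  ·-linear : ∀ {n} (a b v : V n) (s : Carrier) → (λ j → a j + s * b j) · v ≡ a · v + s * (b · v)
  ·-linear {n} a b v s = begin
    sum (λ j → (a j + s * b j) * v j)       ≡⟨ sum-cong-≗ distribute ⟩
    sum (λ j → a j * v j + s * (b j * v j)) ≡⟨ ∑-distrib-+ (λ j → a j * v j) _ ⟩
    a · v + sum (λ j → s * (b j * v j))     ≡⟨ cong (a · v +_) (sym (*-distribˡ-sum {n} s _)) ⟩
    a · v + s * (b · v)                     ∎
    where
      distribute : ∀ j → (a j + s * b j) * v j ≡ a j * v j + s * (b j * v j)
      distribute j = trans (distribʳ (v j) (a j) _) (cong (a j * v j +_) (*-assoc s (b j) (v j)))

  ·-scale : ∀ {n} (a v : V n) (s : Carrier) → (λ j → s * a j) · v ≡ s * (a · v)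
  ·-scale {n} a v s = trans (sum-cong-≗ (λ j → *-assoc s (a j) (v j))) (sym (*-distribˡ-sum {n} s _))

  δ : ∀ {n} → Fin n → V n
  δ i j with i Fin.≟ j
  ... | yes _ = 1#
  ... | no _  = 0#

  δ-diag : ∀ {n} (i : Fin n) → δ i i ≡ 1#
  δ-diag i with i Fin.≟ i
  ... | yes _ = refl
  ... | no i≢i = ⊥-elim (i≢i refl)

  δ-off : ∀ {n} (i j : Fin n) → i ≢ j → δ i j ≡ 0#
  δ-off i j i≢j with i Fin.≟ j
  ... | yes i≡j = ⊥-elim (i≢j i≡j)
  ... | no _    = refl

  δ-sym : ∀ {n} (i j : Fin n) → δ i j ≡ δ j i
  δ-sym i j = by-cases (i Fin.≟ j)
    where
      by-cases : Dec (i ≡ j) → δ i j ≡ δ j i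
      by-cases (yes refl) = refl
      by-cases (no i≢j)   = trans (δ-off i j i≢j) (sym (δ-off j i (λ e → i≢j (sym e))))

  sum-δ : ∀ {n} (f : V n) (i : Fin n) → sum (λ j → f j * δ i j) ≡ f i
  sum-δ {suc n} f i = begin
    sum (λ j → f j * δ i j)                             ≡⟨ sum-remove {i = i} (λ j → f j * δ i j) ⟩
    f i * δ i i + sum (λ j → f (punchIn i j) * δ i (punchIn i j))
      ≡⟨ cong₂ _+_ (trans (cong (f i *_) (δ-diag i)) (*-identityʳ (f i))) (sum-zero _ off-diagonal) ⟩
    f i + 0#                                            ≡⟨ +-identityʳ (f i) ⟩
    f i                                                 ∎
    where
      off-diagonal : ∀ j → f (punchIn i j) * δ i (punchIn i j) ≡ 0#
      off-diagonal j = trans (cong (f (punchIn i j) *_) (δ-off i _ (λ e → Fin.punchInᵢ≢i i j (sym e)))) (zeroʳ _)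

  -- Gaussian elimination.

  comb-insertAt : ∀ {n k} (c : V k) (r : Fin (suc k)) (β : Carrier) (b : Fin (suc k) → V n) j →
                  comb (insertAt c r β) b j ≡ β * b r j + comb c (removeAt b r) j
  comb-insertAt c r β b j = begin
    comb (insertAt c r β) b j
      ≡⟨ sum-remove {i = r} (λ i → insertAt c r β i * b i j) ⟩
    insertAt c r β r * b r j + sum (λ i → insertAt c r β (punchIn r i) * b (punchIn r i) j)
      ≡⟨ cong₂ _+_ (cong (_* b r j) (insertAt-lookup c r β))
                   (sum-cong-≗ (λ i → cong (_* b (punchIn r i) j) (insertAt-punchIn c r β i))) ⟩
    β * b r j + comb c (removeAt b r) j
      ∎

  comb-shear : ∀ {n k} (c g : V k) (x : Fin k → V n) (y : V n) j →
               comb c (λ i j → x i j + g i * y j) j ≡ comb c x j + sum (λ i → c i * g i) * y j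
  comb-shear {k = k} c g x y j = begin
    sum (λ i → c i * (x i j + g i * y j))
      ≡⟨ sum-cong-≗ (λ i → trans (distribˡ (c i) _ _) (cong (c i * x i j +_) (sym (*-assoc (c i) (g i) (y j))))) ⟩
    sum (λ i → c i * x i j + (c i * g i) * y j)
      ≡⟨ ∑-distrib-+ (λ i → c i * x i j) _ ⟩
    comb c x j + sum (λ i → (c i * g i) * y j)
      ≡⟨ cong (comb c x j +_) (sym (*-distribʳ-sum {k} (y j) _)) ⟩
    comb c x j + sum (λ i → c i * g i) * y j
      ∎

  -- One elimination step: if shearing the members other than b_r by multiples gᵢ b_r clears
  -- their first coordinates, a nontrivial relation among the remaining coordinates of the
  -- sheared vectors lifts to a nontrivial relation of b.
  lift-relation : ∀ {m k} (b : Fin (suc k) → V (suc m)) (r : Fin (suc k)) (g : V k) →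
                  (∀ i → b (punchIn r i) zero + g i * b r zero ≡ 0#) →
                  Dependent (λ i j → b (punchIn r i) (suc j) + g i * b r (suc j)) → Dependent b
  lift-relation b r g cleared (c , (i₀ , cᵢ₀≢0) , rel) = insertAt c r S , (punchIn r i₀ , nonzero) , relation
    where
      S = sum (λ i → c i * g i)
      nonzero : insertAt c r S (punchIn r i₀) ≢ 0#
      nonzero e = cᵢ₀≢0 (trans (sym (insertAt-punchIn c r S i₀)) e)
      sheared : ∀ j → comb (insertAt c r S) b j ≡ comb c (λ i j → b (punchIn r i) j + g i * b r j) j
      sheared j = begin
        comb (insertAt c r S) b j           ≡⟨ comb-insertAt c r S b j ⟩
        S * b r j + comb c (removeAt b r) j ≡⟨ +-comm _ _ ⟩
        comb c (removeAt b r) j + S * b r j ≡⟨ sym (comb-shear c g (removeAt b r) (b r) j) ⟩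
        comb c (λ i j → b (punchIn r i) j + g i * b r j) j ∎
      relation : ∀ j → comb (insertAt c r S) b j ≡ 0#
      relation zero    = trans (sheared zero) (sum-zero _ (λ i → trans (cong (c i *_) (cleared i)) (zeroʳ (c i))))
      relation (suc j) = trans (sheared (suc j)) (rel j)

  -- Any m + 1 vectors of F^m satisfy a nontrivial linear relation: eliminate the first
  -- coordinate with a pivot (or drop it if it vanishes throughout) and recurse.
  dependent : ∀ m (b : Fin (suc m) → V m) → Dependent b
  dependent zero    b = (λ _ → 1#) , (zero , 1≢0) , (λ ())
  dependent (suc m) b with Fin.any? (λ r → Dec.¬? (b r zero ≟ 0#))
  ... | yes (r , pivot≢0) =
    lift-relation b r g (λ i → pivot-elimination _ pivot≢0)
      (dependent m (λ i j → b (punchIn r i) (suc j) + g i * b r (suc j)))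
    where
      g : V (suc m)
      g i = - (b (punchIn r i) zero * b r zero ⁻¹)
  ... | no no-pivot =
    lift-relation b zero (λ _ → 0#) cleared
      (dependent m (λ i j → b (suc i) (suc j) + 0# * b zero (suc j)))
    where
      cleared : ∀ i → b (suc i) zero + 0# * b zero zero ≡ 0#
      cleared i = trans (cong₂ _+_ (Dec.decidable-stable (b (suc i) zero ≟ 0#) (λ ne → no-pivot (suc i , ne)))
                                   (zeroˡ _))
                        (+-identityʳ 0#)

  extended-relation : ∀ {n k} (w : V n) (b : Fin k → V n) → Independent b → (c : V (suc k)) →
                      (∀ j → comb c (w ∷ b) j ≡ 0#) → c zero ≡ 0# → ∀ i → c i ≡ 0#
  extended-relation w b indep c rel c₀≡0 zero    = c₀≡0
  extended-relation w b indep c rel c₀≡0 (suc i) = indep (λ i → c (suc i)) tail-relation i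
    where
      tail-relation : ∀ j → comb (λ i → c (suc i)) b j ≡ 0#
      tail-relation j = begin
        comb (λ i → c (suc i)) b j                ≡⟨ sym (+-identityˡ _) ⟩
        0# + comb (λ i → c (suc i)) b j           ≡⟨ cong (_+ comb (λ i → c (suc i)) b j) (sym head-term) ⟩
        c zero * w j + comb (λ i → c (suc i)) b j ≡⟨ rel j ⟩
        0#                                        ∎
        where
          head-term : c zero * w j ≡ 0#
          head-term = trans (cong (_* w j) c₀≡0) (zeroˡ (w j))

  -- m independent vectors span F^m: a nontrivial relation of v ∷ b involves v, solve for it.
  spanning : ∀ m (b : Fin m → V m) → Independent b → ∀ v → v ∈⟨ b ⟩
  spanning m b indep v with dependent m (v ∷ b)
  ... | c , (i₀ , cᵢ₀≢0) , rel with c zero ≟ 0#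
  ...   | yes c₀≡0 = ⊥-elim (cᵢ₀≢0 (extended-relation v b indep c rel c₀≡0 i₀))
  ...   | no c₀≢0  = (λ i → t * c (suc i)) , solve
    where
      c₀⁻¹ = c zero ⁻¹
      t = - c₀⁻¹
      solve : ∀ j → v j ≡ comb (λ i → t * c (suc i)) b j
      solve j = begin
        v j                                  ≡⟨ sym (⁻¹-cancelˡ c₀≢0 (v j)) ⟩
        c₀⁻¹ * (c zero * v j)                ≡⟨ cong (c₀⁻¹ *_) (inverseˡ-unique _ _ (rel j)) ⟩
        c₀⁻¹ * - X                           ≡⟨ sym (-‿distribʳ-* c₀⁻¹ X) ⟩
        - (c₀⁻¹ * X)                         ≡⟨ -‿distribˡ-* c₀⁻¹ X ⟩
        t * X                                ≡⟨ *-distribˡ-sum {m} t _ ⟩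
        sum (λ i → t * (c (suc i) * b i j))  ≡⟨ sum-cong-≗ (λ i → sym (*-assoc t (c (suc i)) (b i j))) ⟩
        comb (λ i → t * c (suc i)) b j       ∎
        where X = comb (λ i → c (suc i)) b j

  -- Hyperplanes.

  record Normal {n k} (b : Fin k → V n) : Set where
    field
      vector     : V n
      pivot      : Fin n
      pivot≢0    : vector pivot ≢ 0#
      orthogonal : ∀ i → vector · b i ≡ 0#

  -- m vectors of F^(m+1) have a normal: a nontrivial relation among their m + 1 coordinate rows.
  normal : ∀ m (b : Fin m → V (suc m)) → Normal b
  normal m b with dependent m (λ j i → b i j)
  ... | a , (k , aₖ≢0) , rel = record { vector = a ; pivot = k ; pivot≢0 = aₖ≢0 ; orthogonal = rel }

  -- The standard basis of the hyperplane a⊥ for a pivot aₖ ≢ 0: its i-th vector is the unit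
  -- vector δᵢ off the pivot, completed by - a_(k↑i) / aₖ at the pivot.
  pivotRatio : ∀ {m} (a : V (suc m)) k → Fin m → Carrier
  pivotRatio a k i = - (a (punchIn k i) * a k ⁻¹)

  hyperplaneBasis : ∀ {m} (a : V (suc m)) k → Fin m → V (suc m)
  hyperplaneBasis a k i = insertAt (δ i) k (pivotRatio a k i)

  ·-hyperplaneBasis : ∀ {m} (w a : V (suc m)) k i →
                      w · hyperplaneBasis a k i ≡ w k * pivotRatio a k i + w (punchIn k i)
  ·-hyperplaneBasis w a k i = begin
    w · e
      ≡⟨ sum-remove {i = k} (λ j → w j * e j) ⟩
    w k * e k + sum (λ l → w (punchIn k l) * e (punchIn k l))
      ≡⟨ cong₂ _+_ (cong (w k *_) (insertAt-lookup (δ i) k s))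
                   (sum-cong-≗ (λ l → cong (w (punchIn k l) *_) (insertAt-punchIn (δ i) k s l))) ⟩
    w k * s + sum (λ l → w (punchIn k l) * δ i l)
      ≡⟨ cong (w k * s +_) (sum-δ (λ l → w (punchIn k l)) i) ⟩
    w k * s + w (punchIn k i)
      ∎
    where
      s = pivotRatio a k i
      e = hyperplaneBasis a k i

  hyperplaneBasis-⊥ : ∀ {m} (a : V (suc m)) k (aₖ≢0 : a k ≢ 0#) i → a · hyperplaneBasis a k i ≡ 0#
  hyperplaneBasis-⊥ a k aₖ≢0 i = begin
    a · hyperplaneBasis a k i   ≡⟨ ·-hyperplaneBasis a a k i ⟩
    a k * pivotRatio a k i + x  ≡⟨ +-comm _ x ⟩
    x + a k * pivotRatio a k i  ≡⟨ cong (x +_) (*-comm (a k) _) ⟩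
    x + pivotRatio a k i * a k  ≡⟨ pivot-elimination x aₖ≢0 ⟩
    0#                          ∎
    where
      x = a (punchIn k i)

  -- The basis vectors are independent: at the coordinate k↑i only the i-th one is nonzero.
  hyperplaneBasis-independent : ∀ {m} (a : V (suc m)) k → Independent (hyperplaneBasis a k)
  hyperplaneBasis-independent a k c rel i = begin
    c i                                        ≡⟨ sym (sum-δ c i) ⟩
    sum (λ l → c l * δ i l)                    ≡⟨ sum-cong-≗ (λ l → cong (c l *_) (coordinate l)) ⟩
    comb c (hyperplaneBasis a k) (punchIn k i) ≡⟨ rel (punchIn k i) ⟩
    0#                                         ∎
    where
      coordinate : ∀ l → δ i l ≡ hyperplaneBasis a k l (punchIn k i)
      coordinate l = trans (δ-sym i l) (sym (insertAt-punchIn (δ l) k _ i))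

  -- An independent family b of m vectors in F^(m+1) spans the hyperplane orthogonal to its
  -- normal a: δₖ ∷ b is a basis of F^(m+1), and a · v = 0 kills the coefficient of δₖ.
  ⊥⊆span : ∀ {m} (b : Fin m → V (suc m)) → Independent b → (N : Normal b) →
           ∀ v → Normal.vector N · v ≡ 0# → v ∈⟨ b ⟩
  ⊥⊆span {m} b indep N v v⊥a = (λ i → d (suc i)) , coordinates
    where
      open Normal N renaming (vector to a; pivot to k)
      ·-extended : ∀ c → a · comb c (δ k ∷ b) ≡ c zero * a k
      ·-extended c = begin
        a · comb c (δ k ∷ b)
          ≡⟨ ·-comb a c (δ k ∷ b) ⟩
        c zero * (a · δ k) + sum (λ i → c (suc i) * (a · b i))
          ≡⟨ cong₂ _+_ (cong (c zero *_) (sum-δ a k))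
                       (sum-zero _ (λ i → trans (cong (c (suc i) *_) (orthogonal i)) (zeroʳ _))) ⟩
        c zero * a k + 0#
          ≡⟨ +-identityʳ _ ⟩
        c zero * a k
          ∎
      first-coefficient : ∀ c → a · comb c (δ k ∷ b) ≡ 0# → c zero ≡ 0#
      first-coefficient c ⊥ =
        *-cancel-nonzero (a k) (c zero) pivot≢0 (trans (*-comm _ _) (trans (sym (·-extended c)) ⊥))
      basis : Independent (δ k ∷ b)
      basis c rel = extended-relation (δ k) b indep c rel
        (first-coefficient c (sum-zero _ (λ j → trans (cong (a j *_) (rel j)) (zeroʳ (a j)))))
      v∈span = spanning (suc m) (δ k ∷ b) basis v
      d = proj₁ v∈span
      d₀≡0 : d zero ≡ 0#
      d₀≡0 = first-coefficient d (trans (sym (·-congʳ a (proj₂ v∈span))) v⊥a)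
      coordinates : ∀ j → v j ≡ comb (λ i → d (suc i)) b j
      coordinates j = trans (proj₂ v∈span j)
        (trans (cong (_+ comb (λ i → d (suc i)) b j) (trans (cong (_* δ k j) d₀≡0) (zeroˡ _))) (+-identityˡ _))

  agree-around : ∀ {m} {A : Set} (k : Fin (suc m)) {f g : Fin (suc m) → A} →
                 f k ≡ g k → (∀ i → f (punchIn k i) ≡ g (punchIn k i)) → ∀ j → f j ≡ g j
  agree-around k {f} {g} fₖ≡gₖ around j with k Fin.≟ j
  ... | yes refl = fₖ≡gₖ
  ... | no k≢j   = subst (λ x → f x ≡ g x) (Fin.punchIn-punchOut k≢j) (around (punchOut k≢j))

  -- Two forms that agree on the hyperplane a⊥ and at a pivot of a are equal: off the pivot,
  -- compare them on the basis vectors of a⊥.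
  agree-on-⊥ : ∀ {m} (a g h : V (suc m)) k (aₖ≢0 : a k ≢ 0#) →
               (∀ v → a · v ≡ 0# → g · v ≡ h · v) → g k ≡ h k → ∀ j → g j ≡ h j
  agree-on-⊥ a g h k aₖ≢0 agree gₖ≡hₖ = agree-around k gₖ≡hₖ off-pivot
    where
      off-pivot : ∀ i → g (punchIn k i) ≡ h (punchIn k i)
      off-pivot i = ∙-cancelˡ (g k * s) _ _ (begin
        g k * s + g (punchIn k i) ≡⟨ sym (·-hyperplaneBasis g a k i) ⟩
        g · e                     ≡⟨ agree e (hyperplaneBasis-⊥ a k aₖ≢0 i) ⟩
        h · e                     ≡⟨ ·-hyperplaneBasis h a k i ⟩
        h k * s + h (punchIn k i) ≡⟨ cong (λ x → x * s + h (punchIn k i)) (sym gₖ≡hₖ) ⟩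
        g k * s + h (punchIn k i) ∎)
        where
          s = pivotRatio a k i
          e = hyperplaneBasis a k i

  comb-comb : ∀ {n k l} (λ' : V k) (D : Fin k → V l) (C : Fin l → V n) j →
              comb λ' (λ i → comb (D i) C) j ≡ comb (comb λ' D) C j
  comb-comb {k = k} {l} λ' D C j = begin
    sum (λ i → λ' i * sum (λ y → D i y * C y j))   ≡⟨ sum-cong-≗ (λ i → *-distribˡ-sum {l} (λ' i) _) ⟩
    sum (λ i → sum (λ y → λ' i * (D i y * C y j))) ≡⟨ ∑-comm (λ i y → λ' i * (D i y * C y j)) ⟩
    sum (λ y → sum (λ i → λ' i * (D i y * C y j))) ≡⟨ sum-cong-≗ (λ y → sum-cong-≗ (λ i → reassociate i y)) ⟩
    sum (λ y → sum (λ i → (λ' i * D i y) * C y j)) ≡⟨ sum-cong-≗ (λ y → sym (*-distribʳ-sum {k} (C y j) _)) ⟩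
    comb (comb λ' D) C j                           ∎
    where
      reassociate : ∀ i y → λ' i * (D i y * C y j) ≡ (λ' i * D i y) * C y j
      reassociate i y = sym (*-assoc (λ' i) (D i y) (C y j))

  composite-independent : ∀ {n k l} (D : Fin k → V l) (C : Fin l → V n) →
                          Independent D → Independent C → Independent (λ i → comb (D i) C)
  composite-independent D C indep-D indep-C λ' rel =
    indep-D λ' (indep-C (comb λ' D) (λ j → trans (sym (comb-comb λ' D C j)) (rel j)))

  -- If Aⱼ ≢ 0, aⱼ = 0 and aₖ ≢ 0, the hyperplanes A⊥ and a⊥ of F^(m+2) contain m common
  -- independent vectors: recombine the basis of A⊥ along the basis of ρ⊥, where ρ is a with
  -- its j-th coordinate removed.
  common-family : ∀ {m} (A a : V (suc (suc m))) j k → A j ≢ 0# → a j ≡ 0# → a k ≢ 0# →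
                  Σ (Fin m → V (suc (suc m))) λ T →
                    Independent T × (∀ l → A · T l ≡ 0#) × (∀ l → a · T l ≡ 0#)
  common-family {m} A a j k Aⱼ≢0 aⱼ≡0 aₖ≢0 =
    T , composite-independent D C (hyperplaneBasis-independent ρ y) (hyperplaneBasis-independent A j)
      , T⊥A , T⊥a
    where
      j≢k : j ≢ k
      j≢k j≡k = aₖ≢0 (trans (cong a (sym j≡k)) aⱼ≡0)
      y = punchOut j≢k
      ρ : V (suc m)
      ρ = removeAt a j
      ρy≢0 : ρ y ≢ 0#
      ρy≢0 e = aₖ≢0 (trans (cong a (sym (Fin.punchIn-punchOut j≢k))) e)
      C = hyperplaneBasis A j
      D = hyperplaneBasis ρ y
      T : Fin m → V (suc (suc m))
      T l = comb (D l) C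
      T⊥A : ∀ l → A · T l ≡ 0#
      T⊥A l = span⊆⊥ A C (hyperplaneBasis-⊥ A j Aⱼ≢0) (T l) (D l , λ _ → refl)
      a·C : ∀ y' → a · C y' ≡ ρ y'
      a·C y' = begin
        a · C y'                       ≡⟨ ·-hyperplaneBasis a A j y' ⟩
        a j * pivotRatio A j y' + ρ y' ≡⟨ cong (λ z → z * pivotRatio A j y' + ρ y') aⱼ≡0 ⟩
        0# * pivotRatio A j y' + ρ y'  ≡⟨ cong (_+ ρ y') (zeroˡ _) ⟩
        0# + ρ y'                      ≡⟨ +-identityˡ (ρ y') ⟩
        ρ y'                           ∎
      T⊥a : ∀ l → a · T l ≡ 0#
      T⊥a l = begin
        a · T l                          ≡⟨ ·-comb a (D l) C ⟩
        sum (λ y' → D l y' * (a · C y')) ≡⟨ sum-cong-≗ (λ y' → cong (D l y' *_) (a·C y')) ⟩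
        D l · ρ                          ≡⟨ ·-comm (D l) ρ ⟩
        ρ · D l                          ≡⟨ hyperplaneBasis-⊥ ρ y ρy≢0 l ⟩
        0#                               ∎

  -- Subspaces are given in Defs by bases of Vec-vectors; b represents the family f of
  -- coordinate functions when their coordinates agree.
  _represents_ : ∀ {n k} → (Fin k → Vec Carrier n) → (Fin k → V n) → Set
  b represents f = ∀ i j → lookup (b i) j ≡ f i j

  lookup-ext : ∀ {n} (v w : Vec Carrier n) → (∀ j → lookup v j ≡ lookup w j) → v ≡ w
  lookup-ext v w v≗w = begin
    v                       ≡⟨ sym (Vecₚ.tabulate∘lookup v) ⟩
    Vec.tabulate (lookup v) ≡⟨ Vecₚ.tabulate-cong v≗w ⟩
    Vec.tabulate (lookup w) ≡⟨ Vecₚ.tabulate∘lookup w ⟩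
    w                       ∎

  lookup-lincomb : ∀ {n k} (c : V k) (b : Fin k → Vec Carrier n) j →
                   lookup (lincomb F c b) j ≡ comb c (λ i → lookup (b i)) j
  lookup-lincomb {n} {zero}  c b j = Vecₚ.lookup-replicate j 0#
  lookup-lincomb {n} {suc k} c b j =
    trans (Vecₚ.lookup-zipWith _+_ j (Vec.map (c zero *_) (b zero)) (lincomb F c' b'))
          (cong₂ _+_ (Vecₚ.lookup-map j (c zero *_) (b zero)) (lookup-lincomb c' b' j))
    where
      c' = λ i → c (suc i)
      b' = λ i → b (suc i)

  module _ {n k} (b : Fin k → Vec Carrier n) {f : Fin k → V n} (b≈f : b represents f) where

    lookup-lincomb≈ : ∀ c j → lookup (lincomb F c b) j ≡ comb c f j
    lookup-lincomb≈ c j = trans (lookup-lincomb c b j) (comb-cong c b≈f j)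

    independent⇒LinIndep : Independent f → LinIndep F b
    independent⇒LinIndep indep c zero≡ = indep c (λ j → begin
      comb c f j                    ≡⟨ sym (lookup-lincomb≈ c j) ⟩
      lookup (lincomb F c b) j      ≡⟨ cong (λ v → lookup v j) zero≡ ⟩
      lookup (Vec.replicate n 0#) j ≡⟨ Vecₚ.lookup-replicate j 0# ⟩
      0#                            ∎)

    LinIndep⇒independent : LinIndep F b → Independent f
    LinIndep⇒independent indep c rel =
      indep c (lookup-ext _ _ (λ j → trans (lookup-lincomb≈ c j) (trans (rel j) (sym (Vecₚ.lookup-replicate j 0#)))))

    ∈span⇒∈⟨⟩ : ∀ v → _∈span_ F v b → lookup v ∈⟨ f ⟩
    ∈span⇒∈⟨⟩ v (c , v≡) = c , λ j → trans (cong (λ w → lookup w j) v≡) (lookup-lincomb≈ c j)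

    ∈⟨⟩⇒∈span : ∀ v → lookup v ∈⟨ f ⟩ → _∈span_ F v b
    ∈⟨⟩⇒∈span v (c , v≡) = c , lookup-ext _ _ (λ j → trans (v≡ j) (sym (lookup-lincomb≈ c j)))

  -- Counting: F has q elements, and points of F^m are numbered by Fin (q ^ m).

  injective⇒≤q : ∀ {m} (f : Fin m → Carrier) → (∀ l l' → f l ≡ f l' → l ≡ l') → m ≤ q
  injective⇒≤q f inj = Fin.injective⇒≤ {f = λ l → E.from (f l)} (λ e → inj _ _ (from-injective e))

  funToFin-cong : ∀ {m} {f g : Fin m → Fin q} → (∀ j → f j ≡ g j) → funToFin f ≡ funToFin g
  funToFin-cong {zero}  f≗g = refl
  funToFin-cong {suc m} f≗g = cong₂ combine (f≗g zero) (funToFin-cong (λ j → f≗g (suc j)))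

  point : ∀ {m} → Fin (q ^ m) → V m
  point x j = E.to (finToFun x j)

  point-injective : ∀ {m} (x y : Fin (q ^ m)) → (∀ j → point x j ≡ point y j) → x ≡ y
  point-injective {m} x y same = begin
    x                               ≡⟨ sym (Fin.funToFin-finToFin {m} {q} x) ⟩
    funToFin {m} (finToFun {q} x)   ≡⟨ funToFin-cong {m} same-index ⟩
    funToFin {m} (finToFun {q} y)   ≡⟨ Fin.funToFin-finToFin {m} {q} y ⟩
    y                               ∎
    where
      same-index : ∀ j → finToFun x j ≡ finToFun y j
      same-index j = trans (sym (E.strictlyInverseʳ _)) (trans (cong E.from (same j)) (E.strictlyInverseʳ _))

  injective⇒≤q^ : ∀ {k m} (f : Fin k → V m) → (∀ l l' → (∀ j → f l j ≡ f l' j) → l ≡ l') → k ≤ q ^ m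
  injective⇒≤q^ f inj = Fin.injective⇒≤ {f = λ l → funToFin (λ j → E.from (f l j))}
    (λ {l} {l'} e → inj l l' (λ j → from-injective (begin
      E.from (f l j)                                      ≡⟨ sym (Fin.finToFun-funToFin _ j) ⟩
      finToFun (funToFin (λ j → E.from (f l j))) j        ≡⟨ cong (λ x → finToFun x j) e ⟩
      finToFun (funToFin (λ j → E.from (f l' j))) j       ≡⟨ Fin.finToFun-funToFin _ j ⟩
      E.from (f l' j)                                     ∎)))

  -- The lower bound: the q^(m+1) affine hyperplanes of F^(m+2).

  -- The affine hyperplane { v | v₀ = c · (v₁, …, vₘ) } of F^(m+1) has the normal (1, -c).
  affineNormal : ∀ {m} → V m → V (suc m)
  affineNormal c = 1# ∷ (λ i → - c i)

  affine-equation : ∀ {m} (c : V m) (v : V (suc m)) →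
                    affineNormal c · v ≡ 0# → c · (λ i → v (suc i)) ≡ v zero
  affine-equation {m} c v ⊥ = sym (x∙y⁻¹≈ε⇒x≈y (v zero) X (begin
    v zero + - X                                ≡⟨ cong₂ _+_ (sym (*-identityˡ (v zero))) negated-sum ⟩
    1# * v zero + sum (λ i → - c i * v (suc i)) ≡⟨ ⊥ ⟩
    0#                                          ∎))
    where
      X = c · (λ i → v (suc i))
      negated-sum : - X ≡ sum (λ i → - c i * v (suc i))
      negated-sum = begin
        - X                                  ≡⟨ sym (-1*x≈-x X) ⟩
        - 1# * X                             ≡⟨ *-distribˡ-sum {m} (- 1#) _ ⟩
        sum (λ i → - 1# * (c i * v (suc i))) ≡⟨ sum-cong-≗ (λ i → trans (-1*x≈-x _) (-‿distribˡ-* (c i) _)) ⟩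
        sum (λ i → - c i * v (suc i))        ∎

  affineBlock : ∀ {m} → V m → Fin m → V (suc m)
  affineBlock c = hyperplaneBasis (affineNormal c) zero

  affineBlock-normal : ∀ {m} (c : V m) → Normal (affineBlock c)
  affineBlock-normal c = record
    { vector     = affineNormal c
    ; pivot      = zero
    ; pivot≢0    = 1≢0
    ; orthogonal = hyperplaneBasis-⊥ (affineNormal c) zero 1≢0
    }

  affineBlock-independent : ∀ {m} (c : V m) → Independent (affineBlock c)
  affineBlock-independent c = hyperplaneBasis-independent (affineNormal c) zero

  -- An affine hyperplane determines its point: if the hyperplane of c lies in that of c',
  -- the two normals vanish on the first one and agree at the pivot, hence everywhere.
  affineBlock-determines-point : ∀ {m} (c c' : V m) → (∀ i → affineBlock c i ∈⟨ affineBlock c' ⟩) →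
                                 ∀ i → c i ≡ c' i
  affineBlock-determines-point c c' included i = ⁻¹-injective (same-normal (suc i))
    where
      N = affineNormal c
      N' = affineNormal c'
      block⊥N' : ∀ i → N' · affineBlock c i ≡ 0#
      block⊥N' i = span⊆⊥ N' (affineBlock c') (Normal.orthogonal (affineBlock-normal c')) _ (included i)
      agree : ∀ v → N · v ≡ 0# → N · v ≡ N' · v
      agree v v⊥N = trans v⊥N (sym (span⊆⊥ N' (affineBlock c) block⊥N' v
        (⊥⊆span (affineBlock c) (affineBlock-independent c) (affineBlock-normal c) v v⊥N)))
      same-normal : ∀ j → N j ≡ N' j
      same-normal = agree-on-⊥ N N N' zero 1≢0 agree refl

  -- At most q affine hyperplanes of F^(m+2) contain m given independent vectors T: with T'
  -- the family T with first coordinates dropped, the points c of these hyperplanes satisfy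
  -- c · T'ᵢ = (Tᵢ)₀, so any two of them agree on span T', which is the hyperplane orthogonal
  -- to a normal d of T'; they are therefore determined by their coordinate at the pivot of d.
  affine-pencil-≤q : ∀ {m} (T : Fin m → V (suc (suc m))) → Independent T →
                     ∀ {k} (c : Fin k → V (suc m)) → (∀ l l' → (∀ j → c l j ≡ c l' j) → l ≡ l') →
                     (∀ l i → affineNormal (c l) · T i ≡ 0#) → k ≤ q
  affine-pencil-≤q T indep {zero}  c distinct T⊥ = z≤n
  affine-pencil-≤q {m} T indep {suc k} c distinct T⊥ =
    injective⇒≤q (λ l → c l d-pivot) (λ l l' e → distinct l l' (determined l l' e))
    where
      T' : Fin m → V (suc m)
      T' i j = T i (suc j)
      equation : ∀ l i → c l · T' i ≡ T i zero
      equation l i = affine-equation (c l) (T i) (T⊥ l i)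
      -- a relation among T' whose combination of T has first coordinate 0 is one of T
      T'-independent : Independent T'
      T'-independent λ' rel = indep λ' vanishes
        where
          w = comb λ' T
          w⊥ : affineNormal (c zero) · w ≡ 0#
          w⊥ = span⊆⊥ (affineNormal (c zero)) T (T⊥ zero) w (λ' , λ _ → refl)
          vanishes : ∀ j → w j ≡ 0#
          vanishes zero    = begin
            w zero                     ≡⟨ sym (affine-equation (c zero) w w⊥) ⟩
            c zero · (λ j → w (suc j)) ≡⟨ ·-congʳ (c zero) rel ⟩
            c zero · (λ _ → 0#)        ≡⟨ sum-zero _ (λ j → zeroʳ (c zero j)) ⟩
            0#                         ∎
          vanishes (suc j) = rel j
      open Normal (normal m T') renaming (vector to d; pivot to d-pivot; pivot≢0 to d-pivot≢0)
      same-on-⊥ : ∀ l l' v → d · v ≡ 0# → c l · v ≡ c l' · v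
      same-on-⊥ l l' v v⊥d = agree-on-span (c l) (c l') T' (λ i → trans (equation l i) (sym (equation l' i))) v
        (⊥⊆span T' T'-independent (normal m T') v v⊥d)
      determined : ∀ l l' → c l d-pivot ≡ c l' d-pivot → ∀ j → c l j ≡ c l' j
      determined l l' = agree-on-⊥ d (c l) (c l') d-pivot d-pivot≢0 (same-on-⊥ l l')

  lowerBound : ∀ m → Σ (Fin (q ^ suc m) → Fin (suc m) → Vec Carrier (suc (suc m))) λ B →
               IsPacking F (suc (suc m)) (suc m) m q (q ^ suc m) B
  lowerBound m = B , record { blocks-indep = indep ; blocks-distinct = distinct ; at-most-λ = at-most-q }
    where
      B : Fin (q ^ suc m) → Fin (suc m) → Vec Carrier (suc (suc m))
      B x i = Vec.tabulate (affineBlock (point x) i)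
      B≈ : ∀ x → B x represents affineBlock (point x)
      B≈ x i = Vecₚ.lookup∘tabulate (affineBlock (point x) i)
      block⊥ : ∀ x v → _∈span_ F v (B x) → affineNormal (point x) · lookup v ≡ 0#
      block⊥ x v v∈B = span⊆⊥ (affineNormal (point x)) (affineBlock (point x))
        (Normal.orthogonal (affineBlock-normal (point x))) (lookup v) (∈span⇒∈⟨⟩ (B x) (B≈ x) v v∈B)
      indep : ∀ x → LinIndep F (B x)
      indep x = independent⇒LinIndep (B x) (B≈ x) (affineBlock-independent (point x))
      distinct : ∀ x y → x ≢ y → ¬ SameSpan F (B x) (B y)
      distinct x y x≢y (x⊆y , _) =
        x≢y (point-injective {suc m} x y (affineBlock-determines-point (point x) (point y) included))
        where
          included : ∀ i → affineBlock (point x) i ∈⟨ affineBlock (point y) ⟩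
          included i = ∈⟨⟩-resp {b = affineBlock (point y)} (B≈ x i) (∈span⇒∈⟨⟩ (B y) (B≈ y) (B x i) (x⊆y i))
      at-most-q : (T : Fin m → Vec Carrier (suc (suc m))) → LinIndep F T →
                  ∀ k (f : Fin k → Fin (q ^ suc m)) → Injective _≡_ _≡_ f →
                  (∀ l → _⊆span_ F T (B (f l))) → k ≤ q
      at-most-q T indep-T k f f-injective T⊆ =
        affine-pencil-≤q (λ i → lookup (T i)) (LinIndep⇒independent T (λ _ _ → refl) indep-T)
          (λ l → point (f l)) (λ l l' same → f-injective (point-injective {suc m} (f l) (f l') same))
          (λ l i → block⊥ (f l) (T i) (T⊆ l i))

  -- The upper bound.

  -- Let j₀ be the pivot of the normal of block 0.
  -- A block whose normal a has aⱼ₀ ≢ 0 is affine, and is coded by its normal scaled to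
  -- aⱼ₀ = 1, with the coordinate j₀ removed. A block with aⱼ₀ = 0 meets block 0 in an
  -- m-dimensional subspace contained in the q + 1 hyperplanes a⊥ and (A₀ + s a)⊥ of their
  -- pencil; the q affine ones cannot all be blocks, and the block is labelled by the code of
  -- one that is not.
  module UpperBound (m N : ℕ) (B : Fin (suc N) → Fin (suc m) → Vec Carrier (suc (suc m)))
                    (packing : IsPacking F (suc (suc m)) (suc m) m q (suc N) B) where
    open IsPacking packing

    block : Fin (suc N) → Fin (suc m) → V (suc (suc m))
    block i l = lookup (B i l)

    opaque
      blockNormal : ∀ i → Normal (block i)
      blockNormal i = normal (suc m) (block i)

    a : Fin (suc N) → V (suc (suc m))
    a i = Normal.vector (blockNormal i)

    block⊥ : ∀ i l → a i · block i l ≡ 0#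
    block⊥ i = Normal.orthogonal (blockNormal i)

    ⊥⇒∈block : ∀ i v → a i · lookup v ≡ 0# → _∈span_ F v (B i)
    ⊥⇒∈block i v v⊥ =
      ∈⟨⟩⇒∈span (B i) (λ _ _ → refl) v (⊥⊆span (block i) block-independent (blockNormal i) (lookup v) v⊥)
      where
        block-independent : Independent (block i)
        block-independent = LinIndep⇒independent (B i) (λ _ _ → refl) (blocks-indep i)

    -- Blocks with proportional normals span the same hyperplane, so they coincide.
    proportional⇒same : ∀ i i' t → t ≢ 0# → (∀ x → a i' x ≡ t * a i x) → i ≡ i'
    proportional⇒same i i' t t≢0 a'≡ta with i Fin.≟ i'
    ... | yes i≡i' = i≡i'
    ... | no i≢i'  = ⊥-elim (blocks-distinct i i' i≢i' (i⊆i' , i'⊆i))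
      where
        ·-proportional : ∀ v → a i' · v ≡ t * (a i · v)
        ·-proportional v = trans (·-congˡ v a'≡ta) (·-scale (a i) v t)
        i⊆i' : _⊆span_ F (B i) (B i')
        i⊆i' l = ⊥⇒∈block i' (B i l)
          (trans (·-proportional (block i l)) (trans (cong (t *_) (block⊥ i l)) (zeroʳ t)))
        i'⊆i : _⊆span_ F (B i') (B i)
        i'⊆i l = ⊥⇒∈block i (B i' l)
          (*-cancel-nonzero t _ t≢0 (trans (sym (·-proportional (block i' l))) (block⊥ i' l)))

    j₀ : Fin (suc (suc m))
    j₀ = Normal.pivot (blockNormal zero)

    a₀ⱼ₀≢0 : a zero j₀ ≢ 0#
    a₀ⱼ₀≢0 = Normal.pivot≢0 (blockNormal zero)

    normalized : Fin (suc N) → V (suc (suc m))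
    normalized i x = a i j₀ ⁻¹ * a i x

    normal-from-normalized : ∀ i → a i j₀ ≢ 0# → ∀ x → a i x ≡ a i j₀ * normalized i x
    normal-from-normalized i aᵢⱼ₀≢0 x = sym (⁻¹-cancelˡ′ aᵢⱼ₀≢0 (a i x))

    code : Fin (suc N) → V (suc m)
    code i = removeAt (normalized i) j₀

    -- An affine block is determined by its code, since its normalized normal is 1 at j₀.
    code⇒normalized : ∀ i (w : V (suc (suc m))) → a i j₀ ≢ 0# → w j₀ ≡ 1# →
                      (∀ y → code i y ≡ removeAt w j₀ y) → ∀ x → normalized i x ≡ w x
    code⇒normalized i w aᵢⱼ₀≢0 wⱼ₀≡1 = agree-around j₀ (trans (⁻¹-inverse aᵢⱼ₀≢0) (sym wⱼ₀≡1))

    normalized⇒same : ∀ i i' → a i j₀ ≢ 0# → a i' j₀ ≢ 0# →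
                      (∀ x → normalized i x ≡ normalized i' x) → i ≡ i'
    normalized⇒same i i' aᵢⱼ₀≢0 aᵢ'ⱼ₀≢0 same =
      proportional⇒same i i' t (*-nonzero _ _ aᵢ'ⱼ₀≢0 (⁻¹-nonzero aᵢⱼ₀≢0)) proportional
      where
        t = a i' j₀ * a i j₀ ⁻¹
        proportional : ∀ x → a i' x ≡ t * a i x
        proportional x = begin
          a i' x                        ≡⟨ normal-from-normalized i' aᵢ'ⱼ₀≢0 x ⟩
          a i' j₀ * normalized i' x     ≡⟨ cong (a i' j₀ *_) (sym (same x)) ⟩
          a i' j₀ * (a i j₀ ⁻¹ * a i x) ≡⟨ sym (*-assoc _ _ _) ⟩
          t * a i x                     ∎

    -- The pencil through block i and block 0: its affine members have normals A₀ + s aᵢ.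
    A₀ : V (suc (suc m))
    A₀ = normalized zero

    pencil : Fin (suc N) → Carrier → V (suc (suc m))
    pencil i s x = A₀ x + s * a i x

    pencil-j₀ : ∀ i s → a i j₀ ≡ 0# → pencil i s j₀ ≡ 1#
    pencil-j₀ i s aᵢⱼ₀≡0 = trans (cong₂ (λ u v → u + s * v) (⁻¹-inverse a₀ⱼ₀≢0) aᵢⱼ₀≡0)
                                 (trans (cong (1# +_) (zeroʳ s)) (+-identityʳ 1#))

    pencil-cancel : ∀ i i' s s' → a i j₀ ≡ 0# → a i' j₀ ≡ 0# →
                    (∀ y → pencil i s (punchIn j₀ y) ≡ pencil i' s' (punchIn j₀ y)) →
                    ∀ x → s * a i x ≡ s' * a i' x
    pencil-cancel i i' s s' aᵢⱼ₀≡0 aᵢ'ⱼ₀≡0 same =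
      agree-around j₀ at-j₀ (λ y → ∙-cancelˡ (A₀ (punchIn j₀ y)) _ _ (same y))
      where
        at-j₀ : s * a i j₀ ≡ s' * a i' j₀
        at-j₀ = trans (trans (cong (s *_) aᵢⱼ₀≡0) (zeroʳ s)) (sym (trans (cong (s' *_) aᵢ'ⱼ₀≡0) (zeroʳ s')))

    pencil-injective : ∀ i s s' → a i j₀ ≡ 0# →
                       (∀ y → pencil i s (punchIn j₀ y) ≡ pencil i s' (punchIn j₀ y)) → s ≡ s'
    pencil-injective i s s' aᵢⱼ₀≡0 same = *-cancelʳ-nonzero s s' (Normal.pivot≢0 (blockNormal i))
      (pencil-cancel i i s s' aᵢⱼ₀≡0 aᵢⱼ₀≡0 same (Normal.pivot (blockNormal i)))

    pencil-block : ∀ i i' s → a i j₀ ≡ 0# → a i' j₀ ≢ 0# → (∀ y → code i' y ≡ removeAt (pencil i s) j₀ y) →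
                   ∀ v → A₀ · v ≡ 0# → a i · v ≡ 0# → a i' · v ≡ 0#
    pencil-block i i' s aᵢⱼ₀≡0 aᵢ'ⱼ₀≢0 same v v⊥A₀ v⊥aᵢ = begin
      a i' · v                              ≡⟨ ·-congˡ v (normal-from-normalized i' aᵢ'ⱼ₀≢0) ⟩
      (λ x → a i' j₀ * normalized i' x) · v ≡⟨ ·-scale (normalized i') v (a i' j₀) ⟩
      a i' j₀ * (normalized i' · v)         ≡⟨ cong (a i' j₀ *_) (·-congˡ v normalized≡pencil) ⟩
      a i' j₀ * (pencil i s · v)            ≡⟨ cong (a i' j₀ *_) (·-linear A₀ (a i) v s) ⟩
      a i' j₀ * (A₀ · v + s * (a i · v))    ≡⟨ cong₂ (λ u w → a i' j₀ * (u + s * w)) v⊥A₀ v⊥aᵢ ⟩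
      a i' j₀ * (0# + s * 0#)               ≡⟨ cong (a i' j₀ *_) (trans (+-identityˡ _) (zeroʳ s)) ⟩
      a i' j₀ * 0#                          ≡⟨ zeroʳ _ ⟩
      0#                                    ∎
      where
        normalized≡pencil : ∀ x → normalized i' x ≡ pencil i s x
        normalized≡pencil = code⇒normalized i' (pencil i s) aᵢ'ⱼ₀≢0 (pencil-j₀ i s aᵢⱼ₀≡0) same

    Covered : V (suc m) → Set
    Covered w = ∃ λ i → a i j₀ ≢ 0# × (∀ y → code i y ≡ w y)

    covered? : ∀ w → Dec (Covered w)
    covered? w = Fin.any? (λ i → Dec.¬? (a i j₀ ≟ 0#) Dec.×-dec Fin.all? (λ y → code i y ≟ w y))

    -- If all q affine members of the pencil through a block i with aᵢⱼ₀ = 0 were blocks, the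
    -- m-dimensional intersection of block i and block 0 would lie in q + 1 blocks.
    pencil-not-full : ∀ i → a i j₀ ≡ 0# → ¬ (∀ s → Covered (removeAt (pencil i s) j₀))
    pencil-not-full i aᵢⱼ₀≡0 cover = ℕ.1+n≰n (at-most-λ Tᵥ T-indep (suc q) through through-injective T⊆)
      where
        member : Fin q → Fin (suc N)
        member x = proj₁ (cover (E.to x))
        member-affine : ∀ x → a (member x) j₀ ≢ 0#
        member-affine x = proj₁ (proj₂ (cover (E.to x)))
        member-code : ∀ x y → code (member x) y ≡ removeAt (pencil i (E.to x)) j₀ y
        member-code x = proj₂ (proj₂ (cover (E.to x)))
        through : Fin (suc q) → Fin (suc N)
        through zero    = i
        through (suc x) = member x
        i≢member : ∀ x → i ≢ member x
        i≢member x i≡member = member-affine x (subst (λ i' → a i' j₀ ≡ 0#) i≡member aᵢⱼ₀≡0)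
        members-injective : ∀ x x' → member x ≡ member x' → x ≡ x'
        members-injective x x' e =
          trans (sym (E.strictlyInverseʳ x)) (trans (cong E.from same-parameter) (E.strictlyInverseʳ x'))
          where
            same-parameter : E.to x ≡ E.to x'
            same-parameter = pencil-injective i _ _ aᵢⱼ₀≡0
              (λ y → trans (sym (member-code x y)) (trans (cong (λ i' → code i' y) e) (member-code x' y)))
        through-injective : Injective _≡_ _≡_ through
        through-injective {zero}  {zero}   _ = refl
        through-injective {zero}  {suc x}  e = ⊥-elim (i≢member x e)
        through-injective {suc x} {zero}   e = ⊥-elim (i≢member x (sym e))
        through-injective {suc x} {suc x'} e = cong suc (members-injective x x' e)
        A₀ⱼ₀≢0 : A₀ j₀ ≢ 0#
        A₀ⱼ₀≢0 e = 1≢0 (trans (sym (⁻¹-inverse a₀ⱼ₀≢0)) e)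
        common = common-family A₀ (a i) j₀ (Normal.pivot (blockNormal i))
                   A₀ⱼ₀≢0 aᵢⱼ₀≡0 (Normal.pivot≢0 (blockNormal i))
        T = proj₁ common
        Tᵥ : Fin m → Vec Carrier (suc (suc m))
        Tᵥ l = Vec.tabulate (T l)
        Tᵥ≈T : Tᵥ represents T
        Tᵥ≈T l = Vecₚ.lookup∘tabulate (T l)
        T-indep : LinIndep F Tᵥ
        T-indep = independent⇒LinIndep Tᵥ Tᵥ≈T (proj₁ (proj₂ common))
        T⊥A₀ : ∀ l → A₀ · lookup (Tᵥ l) ≡ 0#
        T⊥A₀ l = trans (·-congʳ A₀ {lookup (Tᵥ l)} (Tᵥ≈T l)) (proj₁ (proj₂ (proj₂ common)) l)
        T⊥aᵢ : ∀ l → a i · lookup (Tᵥ l) ≡ 0#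
        T⊥aᵢ l = trans (·-congʳ (a i) {lookup (Tᵥ l)} (Tᵥ≈T l)) (proj₂ (proj₂ (proj₂ common)) l)
        T⊆ : ∀ l → _⊆span_ F Tᵥ (B (through l))
        T⊆ zero    l = ⊥⇒∈block i (Tᵥ l) (T⊥aᵢ l)
        T⊆ (suc x) l = ⊥⇒∈block (member x) (Tᵥ l)
          (pencil-block i (member x) (E.to x) aᵢⱼ₀≡0 (member-affine x) (member-code x)
             (lookup (Tᵥ l)) (T⊥A₀ l) (T⊥aᵢ l))

    escape : ∀ i → a i j₀ ≡ 0# → Σ Carrier λ s → ¬ Covered (removeAt (pencil i s) j₀)
    escape i aᵢⱼ₀≡0 with Fin.any? (λ x → Dec.¬? (covered? (removeAt (pencil i (E.to x)) j₀)))
    ... | yes (x , uncovered) = E.to x , uncovered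
    ... | no all-covered      = ⊥-elim (pencil-not-full i aᵢⱼ₀≡0 covered)
      where
        covered : ∀ s → Covered (removeAt (pencil i s) j₀)
        covered s = subst (λ s → Covered (removeAt (pencil i s) j₀)) (E.strictlyInverseˡ s)
          (Dec.decidable-stable (covered? _) (λ uncovered → all-covered (E.from s , uncovered)))

    -- Its parameter is nonzero: the member for s = 0 is block 0 itself.
    escape-nonzero : ∀ i (aᵢⱼ₀≡0 : a i j₀ ≡ 0#) → proj₁ (escape i aᵢⱼ₀≡0) ≢ 0#
    escape-nonzero i aᵢⱼ₀≡0 s≡0 = proj₂ (escape i aᵢⱼ₀≡0) (zero , a₀ⱼ₀≢0 , block-0)
      where
        s = proj₁ (escape i aᵢⱼ₀≡0)
        block-0 : ∀ y → code zero y ≡ removeAt (pencil i s) j₀ y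
        block-0 y = sym (begin
          A₀ (punchIn j₀ y) + s * a i (punchIn j₀ y)  ≡⟨ cong (λ t → A₀ (punchIn j₀ y) + t * a i (punchIn j₀ y)) s≡0 ⟩
          A₀ (punchIn j₀ y) + 0# * a i (punchIn j₀ y) ≡⟨ cong (A₀ (punchIn j₀ y) +_) (zeroˡ _) ⟩
          A₀ (punchIn j₀ y) + 0#                      ≡⟨ +-identityʳ _ ⟩
          A₀ (punchIn j₀ y)                           ∎)

    label : ∀ i → Dec (a i j₀ ≡ 0#) → V (suc m)
    label i (no _)        = code i
    label i (yes aᵢⱼ₀≡0) = removeAt (pencil i (proj₁ (escape i aᵢⱼ₀≡0))) j₀

    label-injective : ∀ i i' d d' → (∀ y → label i d y ≡ label i' d' y) → i ≡ i'
    label-injective i i' (no aᵢⱼ₀≢0) (no aᵢ'ⱼ₀≢0) same =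
      normalized⇒same i i' aᵢⱼ₀≢0 aᵢ'ⱼ₀≢0 (code⇒normalized i (normalized i') aᵢⱼ₀≢0 (⁻¹-inverse aᵢ'ⱼ₀≢0) same)
    label-injective i i' (no aᵢⱼ₀≢0) (yes aᵢ'ⱼ₀≡0) same =
      ⊥-elim (proj₂ (escape i' aᵢ'ⱼ₀≡0) (i , aᵢⱼ₀≢0 , same))
    label-injective i i' (yes aᵢⱼ₀≡0) (no aᵢ'ⱼ₀≢0) same =
      ⊥-elim (proj₂ (escape i aᵢⱼ₀≡0) (i' , aᵢ'ⱼ₀≢0 , λ y → sym (same y)))
    label-injective i i' (yes aᵢⱼ₀≡0) (yes aᵢ'ⱼ₀≡0) same =
      proportional⇒same i i' (s' ⁻¹ * s) (*-nonzero _ _ (⁻¹-nonzero s'≢0) (escape-nonzero i aᵢⱼ₀≡0)) proportional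
      where
        s = proj₁ (escape i aᵢⱼ₀≡0)
        s' = proj₁ (escape i' aᵢ'ⱼ₀≡0)
        s'≢0 = escape-nonzero i' aᵢ'ⱼ₀≡0
        proportional : ∀ x → a i' x ≡ (s' ⁻¹ * s) * a i x
        proportional x = begin
          a i' x                ≡⟨ sym (⁻¹-cancelˡ s'≢0 (a i' x)) ⟩
          s' ⁻¹ * (s' * a i' x) ≡⟨ cong (s' ⁻¹ *_) (sym (pencil-cancel i i' s s' aᵢⱼ₀≡0 aᵢ'ⱼ₀≡0 same x)) ⟩
          s' ⁻¹ * (s * a i x)   ≡⟨ sym (*-assoc _ s (a i x)) ⟩
          (s' ⁻¹ * s) * a i x   ∎

    bound : suc N ≤ q ^ suc m
    bound = injective⇒≤q^ (λ i → label i (a i j₀ ≟ 0#))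
                          (λ i i' → label-injective i i' (a i j₀ ≟ 0#) (a i' j₀ ≟ 0#))

  upperBound : ∀ m N (B : Fin N → Fin (suc m) → Vec Carrier (suc (suc m))) →
               IsPacking F (suc (suc m)) (suc m) m q N B → N ≤ q ^ suc m
  upperBound m zero    B _       = z≤n
  upperBound m (suc N) B packing = UpperBound.bound m N B packing

proposition34 : (q : ℕ) (F : FiniteField q) (n : ℕ) → 3 ≤ n →
    Aq≡ F n (n ∸ 1) (n ∸ 2) q (q ^ (n ∸ 1))
proposition34 q F (suc (suc (suc m))) (s≤s (s≤s (s≤s z≤n))) = lowerBound F (suc m) , upperBound F (suc m)
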